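{- Let $r\ge 1$, $n\ge 0$, $s\ge 0$ be integers with $s\le \frac{r-n}{2}$. Then $$L_{r+n}(s+n)=\sum_{k=0}^{n}\binom{n}{k}(-1)^{n-k}L_{r+2k}(s+k).$$
   Context: The incomplete Lucas numbers are $L_m(j)=\sum_{i=0}^{j}\frac{m}{m-i}\binom{m-i}{i}$ for integers $m\ge 1$ and $0\le j\le \left[\frac{m}{2}\right]$, where $[x]$ denotes the integer part of $x$. -}

module Defs where

open import Data.Nat using (ℕ; zero; suc; _∸_; _≤_)
open import Data.Nat.Combinatorics using (_C_)
open import Data.Integer using (ℤ; +_)
open import Data.Rational using (ℚ; 0ℚ; _+_; _*_; -_)
import Data.Rational as Q

-- the summand  m/(m-i) * binom(m-i, i)  as a rational number.
-- When m - i = 0 (never happens for m ≥ 1, i ≤ [m/2]) we return 0 by convention.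
lucasTerm : ℕ → ℕ → ℚ
lucasTerm m i with m ∸ i
... | zero  = 0ℚ
... | suc k = ((+ m) Q./ suc k) * ((+ (suc k C i)) Q./ 1)

sumTo : ℕ → (ℕ → ℚ) → ℚ
sumTo zero    f = f zero
sumTo (suc j) f = sumTo j f + f (suc j)

L : ℕ → ℕ → ℚ
L m j = sumTo j (lucasTerm m)

signPow : ℕ → ℚ
signPow zero    = Q.1ℚ
signPow (suc e) = - signPow e

-- Writing m = k + 1 + i, the summand m/(m-i) C(m-i,i) of L_m is the integer
-- C(k+1,i) + C(k,i-1), and these integers obey Pascal's rule in (k, i).  Summing gives
-- the recurrence L_{m+2}(j+1) = L_{m+1}(j+1) + L_m(j), i.e. L_{r+1}(s+1) = g(1) - g(0)
-- for g(k) = L_{r+2k}(s+k).  The right-hand side of the theorem is (Δⁿ g)(0), so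
-- induction on n, shifting r and s by one, proves the identity: Δⁿ(Δg) = Δⁿ⁺¹g.
module Submission where

open import Defs
open import Data.Nat using (ℕ; zero; suc; _≤_; _<_; _∸_; _*_; _+_; z≤n; s≤s)
open import Data.Nat.Properties
open import Data.Nat.Combinatorics using (_C_; nC1≡n; nCk+nC[k+1]≡[n+1]C[k+1])
open import Data.Nat.Combinatorics.Specification using (k>n⇒nCk≡0)
open import Data.Nat.Tactic.RingSolver using (solve-∀)
import Data.Integer as ℤ
open import Data.Integer using (+_)
import Data.Integer.Properties as ℤ
open import Data.Rational using (ℚ; 0ℚ; 1ℚ)
import Data.Rational as Q
import Data.Rational.Properties as Q
import Data.Rational.Unnormalised as ℚᵘ
import Data.Rational.Unnormalised.Properties as ℚᵘ
import Data.Rational.Solver as QSolver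
open import Relation.Binary.PropositionalEquality using (_≡_; refl; sym; trans; cong; cong₂; module ≡-Reasoning)

fromℕ : ℕ → ℚ
fromℕ n = + n Q./ 1

toℚᵘ-/ : ∀ a k → Q.toℚᵘ (a Q./ suc k) ℚᵘ.≃ ℚᵘ.mkℚᵘ a k
toℚᵘ-/ a k = Q.toℚᵘ-fromℚᵘ (ℚᵘ.mkℚᵘ a k)

fromℕ-+ : ∀ a b → fromℕ (a + b) ≡ fromℕ a Q.+ fromℕ b
fromℕ-+ a b = Q.toℚᵘ-injective (begin
  Q.toℚᵘ (fromℕ (a + b))                      ≈⟨ toℚᵘ-/ (+ (a + b)) 0 ⟩
  ℚᵘ.mkℚᵘ (+ (a + b)) 0                       ≈⟨ ℚᵘ.*≡* cross ⟩
  ℚᵘ.mkℚᵘ (+ a) 0 ℚᵘ.+ ℚᵘ.mkℚᵘ (+ b) 0        ≈⟨ ℚᵘ.+-cong (toℚᵘ-/ (+ a) 0) (toℚᵘ-/ (+ b) 0) ⟨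
  Q.toℚᵘ (fromℕ a) ℚᵘ.+ Q.toℚᵘ (fromℕ b)      ≈⟨ Q.toℚᵘ-homo-+ (fromℕ a) (fromℕ b) ⟨
  Q.toℚᵘ (fromℕ a Q.+ fromℕ b)                ∎)
  where
  open ℚᵘ.≃-Reasoning
  cross : + (a + b) ℤ.* + 1 ≡ (+ a ℤ.* + 1 ℤ.+ + b ℤ.* + 1) ℤ.* + 1
  cross rewrite ℤ.*-identityʳ (+ a) | ℤ.*-identityʳ (+ b) = cong (ℤ._* + 1) (ℤ.pos-+ a b)

/-*-fromℕ : ∀ a b c k → a * b ≡ suc k * c → (+ a Q./ suc k) Q.* fromℕ b ≡ fromℕ c
/-*-fromℕ a b c k ab≡[1+k]c = Q.toℚᵘ-injective (begin
  Q.toℚᵘ ((+ a Q./ suc k) Q.* fromℕ b)          ≈⟨ Q.toℚᵘ-homo-* (+ a Q./ suc k) (fromℕ b) ⟩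
  Q.toℚᵘ (+ a Q./ suc k) ℚᵘ.* Q.toℚᵘ (fromℕ b)  ≈⟨ ℚᵘ.*-cong (toℚᵘ-/ (+ a) k) (toℚᵘ-/ (+ b) 0) ⟩
  ℚᵘ.mkℚᵘ (+ a) k ℚᵘ.* ℚᵘ.mkℚᵘ (+ b) 0          ≈⟨ ℚᵘ.*≡* cross ⟩
  ℚᵘ.mkℚᵘ (+ c) 0                               ≈⟨ toℚᵘ-/ (+ c) 0 ⟨
  Q.toℚᵘ (fromℕ c)                              ∎)
  where
  open ℚᵘ.≃-Reasoning
  cross : (+ a ℤ.* + b) ℤ.* + 1 ≡ + c ℤ.* + (suc k * 1)
  cross rewrite sym (ℤ.pos-* a b) | sym (ℤ.pos-* c (suc k * 1))
              | *-identityʳ (suc k) | ℤ.*-identityʳ (+ (a * b))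
              = cong +_ (trans ab≡[1+k]c (*-comm (suc k) c))

sumTo-cong : ∀ n {f g : ℕ → ℚ} → (∀ i → i ≤ n → f i ≡ g i) → sumTo n f ≡ sumTo n g
sumTo-cong zero    f≗g = f≗g 0 z≤n
sumTo-cong (suc n) f≗g = cong₂ Q._+_ (sumTo-cong n (λ i i≤n → f≗g i (m≤n⇒m≤1+n i≤n))) (f≗g (suc n) ≤-refl)

sumTo-+ : ∀ n (f g : ℕ → ℚ) → sumTo n (λ i → f i Q.+ g i) ≡ sumTo n f Q.+ sumTo n g
sumTo-+ zero    f g = refl
sumTo-+ (suc n) f g = trans (cong (Q._+ (f (suc n) Q.+ g (suc n))) (sumTo-+ n f g))
                            (interchange (sumTo n f) (sumTo n g) (f (suc n)) (g (suc n)))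
  where
  open QSolver.+-*-Solver
  interchange : ∀ a b c d → (a Q.+ b) Q.+ (c Q.+ d) ≡ (a Q.+ c) Q.+ (b Q.+ d)
  interchange = solve 4 (λ a b c d → (a :+ b) :+ (c :+ d) := (a :+ c) :+ (b :+ d)) refl

sumTo-neg : ∀ n (f : ℕ → ℚ) → sumTo n (λ i → Q.- f i) ≡ Q.- sumTo n f
sumTo-neg zero    f = refl
sumTo-neg (suc n) f =
  trans (cong (Q._+ (Q.- f (suc n))) (sumTo-neg n f)) (sym (Q.neg-distrib-+ (sumTo n f) (f (suc n))))

sumTo-minus : ∀ n (f g : ℕ → ℚ) → sumTo n (λ i → f i Q.- g i) ≡ sumTo n f Q.- sumTo n g
sumTo-minus n f g = trans (sumTo-+ n f (λ i → Q.- g i)) (cong (sumTo n f Q.+_) (sumTo-neg n g))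

sumTo-suc-head : ∀ n (f : ℕ → ℚ) → sumTo (suc n) f ≡ f 0 Q.+ sumTo n (λ i → f (suc i))
sumTo-suc-head zero    f = refl
sumTo-suc-head (suc n) f = trans (cong (Q._+ f (suc (suc n))) (sumTo-suc-head n f)) (Q.+-assoc (f 0) _ _)

[1+k]C[1+i]-absorption : ∀ k i → suc i * (suc k C suc i) ≡ suc k * (k C i)
[1+k]C[1+i]-absorption zero    zero    = refl
[1+k]C[1+i]-absorption zero    (suc i) =
  trans (cong (suc (suc i) *_) (k>n⇒nCk≡0 {1} {suc (suc i)} (s≤s (s≤s z≤n)))) (*-zeroʳ (suc (suc i)))
[1+k]C[1+i]-absorption (suc k) zero    =
  trans (*-identityˡ _) (trans (nC1≡n (suc (suc k))) (sym (*-identityʳ (suc (suc k)))))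
[1+k]C[1+i]-absorption (suc k) (suc i) = begin
  suc (suc i) * (suc (suc k) C suc (suc i))         ≡⟨ cong (suc (suc i) *_) (pascal (suc k) (suc i)) ⟨
  suc (suc i) * (x + y)                             ≡⟨ distrib i x y ⟩
  suc i * x + x + suc (suc i) * y                   ≡⟨ cong₂ (λ u v → u + x + v) ([1+k]C[1+i]-absorption k i)
                                                                                ([1+k]C[1+i]-absorption k (suc i)) ⟩
  suc k * (k C i) + x + suc k * (k C suc i)         ≡⟨ regroup k x (k C i) (k C suc i) ⟩
  x + suc k * (k C i + k C suc i)                   ≡⟨ cong (λ u → x + suc k * u) (pascal k i) ⟩
  x + suc k * x                                     ∎
  where
  open ≡-Reasoning
  pascal : ∀ n k → n C k + n C suc k ≡ suc n C suc k
  pascal = nCk+nC[k+1]≡[n+1]C[k+1]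
  x y : ℕ
  x = suc k C suc i
  y = suc k C suc (suc i)
  distrib : ∀ i x y → suc (suc i) * (x + y) ≡ suc i * x + x + suc (suc i) * y
  distrib = solve-∀
  regroup : ∀ k x a b → suc k * a + x + suc k * b ≡ x + suc k * (a + b)
  regroup = solve-∀

-- The i-th summand of L_{k+1+i}:  (k+1+i)/(k+1) · C(k+1,i) = C(k+1,i) + C(k,i-1).
lucasSummand : ℕ → ℕ → ℕ
lucasSummand k zero    = 1
lucasSummand k (suc i) = suc k C suc i + k C i

lucasSummand-absorption : ∀ k i → (suc k + i) * (suc k C i) ≡ suc k * lucasSummand k i
lucasSummand-absorption k zero    = cong (_* 1) (+-identityʳ (suc k))
lucasSummand-absorption k (suc i) = begin
  (suc k + suc i) * x               ≡⟨ *-distribʳ-+ x (suc k) (suc i) ⟩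
  suc k * x + suc i * x             ≡⟨ cong (λ u → suc k * x + u) ([1+k]C[1+i]-absorption k i) ⟩
  suc k * x + suc k * (k C i)       ≡⟨ *-distribˡ-+ (suc k) x (k C i) ⟨
  suc k * (x + k C i)               ∎
  where
  open ≡-Reasoning
  x : ℕ
  x = suc k C suc i

lucasSummand-pascal : ∀ k i → lucasSummand (suc k) (suc i) ≡ lucasSummand k (suc i) + lucasSummand k i
lucasSummand-pascal k zero    = begin
  suc (suc k) C 1 + 1     ≡⟨ cong (_+ 1) (nC1≡n (suc (suc k))) ⟩
  1 + suc k + 1           ≡⟨ cong (_+ 1) (+-comm 1 (suc k)) ⟩
  suc k + 1 + 1           ≡⟨ cong (λ u → u + 1 + 1) (nC1≡n (suc k)) ⟨
  suc k C 1 + 1 + 1       ∎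
  where open ≡-Reasoning
lucasSummand-pascal k (suc i) = begin
  suc (suc k) C suc (suc i) + suc k C suc i                     ≡⟨ cong₂ _+_ (pascal (suc k) (suc i)) (pascal k i) ⟨
  (suc k C suc i + suc k C suc (suc i)) + (k C i + k C suc i)   ≡⟨ regroup (suc k C suc i) _ (k C i) _ ⟩
  (suc k C suc (suc i) + k C suc i) + (suc k C suc i + k C i)   ∎
  where
  open ≡-Reasoning
  pascal : ∀ n k → n C k + n C suc k ≡ suc n C suc k
  pascal = nCk+nC[k+1]≡[n+1]C[k+1]
  regroup : ∀ a b c d → (a + b) + (c + d) ≡ (b + d) + (a + c)
  regroup = solve-∀

lucasTerm≡lucasSummand : ∀ {m} k i → m ≡ suc k + i → lucasTerm m i ≡ fromℕ (lucasSummand k i)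
lucasTerm≡lucasSummand k i refl rewrite m+n∸n≡m (suc k) i =
  /-*-fromℕ (suc k + i) (suc k C i) (lucasSummand k i) k (lucasSummand-absorption k i)

lucasTerm-zero : ∀ m → lucasTerm (suc m) 0 ≡ 1ℚ
lucasTerm-zero m = lucasTerm≡lucasSummand m 0 (sym (+-identityʳ (suc m)))

lucasTerm-pascal : ∀ {m i} → i < m →
  lucasTerm (suc (suc m)) (suc i) ≡ lucasTerm (suc m) (suc i) Q.+ lucasTerm m i
lucasTerm-pascal {m} {i} i<m = begin
  lucasTerm (suc (suc m)) (suc i)                              ≡⟨ lucasTerm≡lucasSummand (suc k) (suc i) (cong suc 1+m≡) ⟩
  fromℕ (lucasSummand (suc k) (suc i))                         ≡⟨ cong fromℕ (lucasSummand-pascal k i) ⟩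
  fromℕ (lucasSummand k (suc i) + lucasSummand k i)            ≡⟨ fromℕ-+ (lucasSummand k (suc i)) (lucasSummand k i) ⟩
  fromℕ (lucasSummand k (suc i)) Q.+ fromℕ (lucasSummand k i)  ≡⟨ cong₂ Q._+_ (lucasTerm≡lucasSummand k (suc i) 1+m≡)
                                                                              (lucasTerm≡lucasSummand k i m≡) ⟨
  lucasTerm (suc m) (suc i) Q.+ lucasTerm m i                  ∎
  where
  open ≡-Reasoning
  k : ℕ
  k = m ∸ suc i
  1+m≡ : suc m ≡ suc k + suc i
  1+m≡ = cong suc (sym (m∸n+n≡m i<m))
  m≡ : m ≡ suc k + i
  m≡ = trans (sym (m∸n+n≡m i<m)) (+-suc k i)

L-pascal : ∀ {m j} → j < m → L (suc (suc m)) (suc j) ≡ L (suc m) (suc j) Q.+ L m j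
L-pascal {m} {j} j<m = begin
  L (suc (suc m)) (suc j)                                          ≡⟨ sumTo-suc-head j (lucasTerm (suc (suc m))) ⟩
  lucasTerm (suc (suc m)) 0 Q.+ sumTo j (λ i → lucasTerm (suc (suc m)) (suc i))
                                                                   ≡⟨ cong₂ Q._+_ (lucasTerm-zero (suc m))
                                                                        (sumTo-cong j (λ i i≤j → lucasTerm-pascal (≤-<-trans i≤j j<m))) ⟩
  1ℚ Q.+ sumTo j (λ i → lucasTerm (suc m) (suc i) Q.+ lucasTerm m i)
                                                                   ≡⟨ cong (1ℚ Q.+_) (sumTo-+ j _ (lucasTerm m)) ⟩
  1ℚ Q.+ (tail Q.+ L m j)                                          ≡⟨ Q.+-assoc 1ℚ tail (L m j) ⟨
  (1ℚ Q.+ tail) Q.+ L m j                                          ≡⟨ cong (λ h → (h Q.+ tail) Q.+ L m j) (lucasTerm-zero m) ⟨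
  (lucasTerm (suc m) 0 Q.+ tail) Q.+ L m j                         ≡⟨ cong (Q._+ L m j) (sumTo-suc-head j (lucasTerm (suc m))) ⟨
  L (suc m) (suc j) Q.+ L m j                                      ∎
  where
  open ≡-Reasoning
  tail : ℚ
  tail = sumTo j (λ i → lucasTerm (suc m) (suc i))

Δ : (ℕ → ℚ) → ℕ → ℚ
Δ g k = g (suc k) Q.- g k

-- (Δⁿ g)(0), expanded by the binomial theorem.
Δⁿ₀ : ℕ → (ℕ → ℚ) → ℚ
Δⁿ₀ n g = sumTo n (λ k → fromℕ (n C k) Q.* (signPow (n ∸ k) Q.* g k))

Δⁿ₀-cong : ∀ n {f g : ℕ → ℚ} → (∀ k → k ≤ n → f k ≡ g k) → Δⁿ₀ n f ≡ Δⁿ₀ n g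
Δⁿ₀-cong n f≗g = sumTo-cong n (λ k k≤n → cong (λ x → fromℕ (n C k) Q.* (signPow (n ∸ k) Q.* x)) (f≗g k k≤n))

Δⁿ₀-minus : ∀ n (f g : ℕ → ℚ) → Δⁿ₀ n (λ k → f k Q.- g k) ≡ Δⁿ₀ n f Q.- Δⁿ₀ n g
Δⁿ₀-minus n f g = trans (sumTo-cong n (λ k _ → distrib (fromℕ (n C k)) (signPow (n ∸ k)) (f k) (g k)))
                        (sumTo-minus n _ _)
  where
  open QSolver.+-*-Solver
  distrib : ∀ c s a b → c Q.* (s Q.* (a Q.- b)) ≡ c Q.* (s Q.* a) Q.- c Q.* (s Q.* b)
  distrib = solve 4 (λ c s a b → c :* (s :* (a :- b)) := c :* (s :* a) :- c :* (s :* b)) refl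

-- Pascal's rule splits each coefficient C(n+1,k+1); the terms with C(n,k+1) re-assemble,
-- up to the vanishing term C(n,n+1), into a sum with signs (-1)^(n+1-k) = -(-1)^(n-k).
Δⁿ₀-suc : ∀ n (g : ℕ → ℚ) → Δⁿ₀ (suc n) g ≡ Δⁿ₀ n (λ k → g (suc k)) Q.- Δⁿ₀ n g
Δⁿ₀-suc n g = begin
  Δⁿ₀ (suc n) g                               ≡⟨ sumTo-suc-head n F ⟩
  F 0 Q.+ sumTo n (λ k → F (suc k))           ≡⟨ cong (F 0 Q.+_) (sumTo-cong n (λ k _ → F-pascal k)) ⟩
  F 0 Q.+ sumTo n (λ k → A k Q.+ B k)         ≡⟨ cong (F 0 Q.+_) (sumTo-+ n A B) ⟩
  F 0 Q.+ (sumTo n A Q.+ sumTo n B)           ≡⟨ swap (F 0) (sumTo n A) (sumTo n B) ⟩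
  sumTo n A Q.+ (F 0 Q.+ sumTo n B)           ≡⟨ cong (sumTo n A Q.+_) (sumTo-suc-head n G) ⟨
  sumTo n A Q.+ sumTo (suc n) G               ≡⟨ cong (sumTo n A Q.+_) G-drop-last ⟩
  sumTo n A Q.+ sumTo n G                     ≡⟨ cong (sumTo n A Q.+_) (trans (sumTo-cong n G≡-term) (sumTo-neg n _)) ⟩
  Δⁿ₀ n (λ k → g (suc k)) Q.- Δⁿ₀ n g         ∎
  where
  open ≡-Reasoning
  F A B G : ℕ → ℚ
  F k = fromℕ (suc n C k) Q.* (signPow (suc n ∸ k) Q.* g k)
  A k = fromℕ (n C k) Q.* (signPow (n ∸ k) Q.* g (suc k))
  B k = fromℕ (n C suc k) Q.* (signPow (n ∸ k) Q.* g (suc k))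
  G k = fromℕ (n C k) Q.* (signPow (suc n ∸ k) Q.* g k)

  F-pascal : ∀ k → F (suc k) ≡ A k Q.+ B k
  F-pascal k = begin
    fromℕ (suc n C suc k) Q.* w                       ≡⟨ cong (λ c → fromℕ c Q.* w) (nCk+nC[k+1]≡[n+1]C[k+1] n k) ⟨
    fromℕ (n C k + n C suc k) Q.* w                   ≡⟨ cong (Q._* w) (fromℕ-+ (n C k) (n C suc k)) ⟩
    (fromℕ (n C k) Q.+ fromℕ (n C suc k)) Q.* w       ≡⟨ Q.*-distribʳ-+ w (fromℕ (n C k)) (fromℕ (n C suc k)) ⟩
    A k Q.+ B k                                       ∎
    where
    w : ℚ
    w = signPow (n ∸ k) Q.* g (suc k)

  swap : ∀ a b c → a Q.+ (b Q.+ c) ≡ b Q.+ (a Q.+ c)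
  swap a b c = trans (sym (Q.+-assoc a b c)) (trans (cong (Q._+ c) (Q.+-comm a b)) (Q.+-assoc b a c))

  G-drop-last : sumTo (suc n) G ≡ sumTo n G
  G-drop-last = begin
    sumTo n G Q.+ G (suc n)   ≡⟨ cong (λ c → sumTo n G Q.+ fromℕ c Q.* w) (k>n⇒nCk≡0 {n} {suc n} ≤-refl) ⟩
    sumTo n G Q.+ 0ℚ Q.* w    ≡⟨ cong (sumTo n G Q.+_) (Q.*-zeroˡ w) ⟩
    sumTo n G Q.+ 0ℚ          ≡⟨ Q.+-identityʳ (sumTo n G) ⟩
    sumTo n G                 ∎
    where
    w : ℚ
    w = signPow (suc n ∸ suc n) Q.* g (suc n)

  G≡-term : ∀ k → k ≤ n → G k ≡ Q.- (fromℕ (n C k) Q.* (signPow (n ∸ k) Q.* g k))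
  G≡-term k k≤n = begin
    fromℕ (n C k) Q.* (signPow (suc n ∸ k) Q.* g k)      ≡⟨ cong (λ e → fromℕ (n C k) Q.* (signPow e Q.* g k)) (+-∸-assoc 1 k≤n) ⟩
    fromℕ (n C k) Q.* (Q.- signPow (n ∸ k) Q.* g k)      ≡⟨ cong (fromℕ (n C k) Q.*_) (Q.neg-distribˡ-* (signPow (n ∸ k)) (g k)) ⟨
    fromℕ (n C k) Q.* Q.- (signPow (n ∸ k) Q.* g k)      ≡⟨ Q.neg-distribʳ-* (fromℕ (n C k)) (signPow (n ∸ k) Q.* g k) ⟨
    Q.- (fromℕ (n C k) Q.* (signPow (n ∸ k) Q.* g k))    ∎

Δⁿ₀-Δ : ∀ n (g : ℕ → ℚ) → Δⁿ₀ n (Δ g) ≡ Δⁿ₀ (suc n) g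
Δⁿ₀-Δ n g = trans (Δⁿ₀-minus n (λ k → g (suc k)) g) (sym (Δⁿ₀-suc n g))

L-shift-Δ : ∀ {r s} → s < r → ∀ k →
  L (suc r + 2 * k) (suc s + k) ≡ Δ (λ k → L (r + 2 * k) (s + k)) k
L-shift-Δ {r} {s} s<r k = begin
  L (suc M) (suc J)                                ≡⟨ cancel (L (suc M) (suc J)) (L M J) ⟩
  (L (suc M) (suc J) Q.+ L M J) Q.- L M J          ≡⟨ cong (Q._- L M J) (L-pascal J<M) ⟨
  L (suc (suc M)) (suc J) Q.- L M J                ≡⟨ cong₂ (λ m j → L m j Q.- L M J) (2+r+2k≡r+2[1+k] r k) (sym (+-suc s k)) ⟩
  L (r + 2 * suc k) (s + suc k) Q.- L M J          ∎
  where
  open ≡-Reasoning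
  M J : ℕ
  M = r + 2 * k
  J = s + k
  J<M : J < M
  J<M = +-mono-<-≤ s<r (m≤n*m k 2)
  cancel : ∀ a b → a ≡ (a Q.+ b) Q.- b
  cancel = solve 2 (λ a b → a := (a :+ b) :- b) refl
    where open QSolver.+-*-Solver
  2+r+2k≡r+2[1+k] : ∀ r k → suc (suc (r + 2 * k)) ≡ r + 2 * suc k
  2+r+2k≡r+2[1+k] = solve-∀

L-binomialΔ : ∀ n {r s} → s < r → L (r + n) (s + n) ≡ Δⁿ₀ n (λ k → L (r + 2 * k) (s + k))
L-binomialΔ zero    {r} {s} _   = sym (trans (Q.*-identityˡ _) (Q.*-identityˡ (L (r + 0) (s + 0))))
L-binomialΔ (suc n) {r} {s} s<r = begin
  L (r + suc n) (s + suc n)                       ≡⟨ cong₂ L (+-suc r n) (+-suc s n) ⟩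
  L (suc r + n) (suc s + n)                       ≡⟨ L-binomialΔ n (s≤s s<r) ⟩
  Δⁿ₀ n (λ k → L (suc r + 2 * k) (suc s + k))     ≡⟨ Δⁿ₀-cong n (λ k _ → L-shift-Δ s<r k) ⟩
  Δⁿ₀ n (Δ g)                                     ≡⟨ Δⁿ₀-Δ n g ⟩
  Δⁿ₀ (suc n) g                                   ∎
  where
  open ≡-Reasoning
  g : ℕ → ℚ
  g k = L (r + 2 * k) (s + k)

2s≤r∸n⇒s<r : ∀ r n s → 1 ≤ r → 2 * s ≤ r ∸ n → s < r
2s≤r∸n⇒s<r r n zero    1≤r _      = 1≤r
2s≤r∸n⇒s<r r n (suc s) _   2s≤r∸n =
  <-≤-trans (m<m+n (suc s) (s≤s z≤n)) (≤-trans 2s≤r∸n (m∸n≤m r n))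

mainTheorem8 : (r n s : ℕ) → 1 ≤ r → n ≤ r → 2 * s ≤ r ∸ n →
    L (r Data.Nat.+ n) (s Data.Nat.+ n) ≡
      sumTo n (λ k → ((+ (n C k)) Q./ 1) Q.* (signPow (n ∸ k) Q.* L (r Data.Nat.+ 2 * k) (s Data.Nat.+ k)))
mainTheorem8 r n s 1≤r _ 2s≤r∸n = L-binomialΔ n (2s≤r∸n⇒s<r r n s 1≤r 2s≤r∸n)
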